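{- Let $\sigma^{:}$ and $\pi^{:}$ be decorated permutations on $[n]$ with $\operatorname{rk}(\sigma^{:})=\operatorname{rk}(\pi^{:})-1$. Then the shift intervals $S^{\pi,\sigma}_1,\dots,S^{\pi,\sigma}_n$ are pairwise disjoint with union $[n]$ (i.e. $\bigsqcup_{i=1}^n S^{\pi,\sigma}_i=[n]$ as a multiset union) if and only if $S^{\sigma}_i\subseteq S^{\pi}_i$ for all $i\in[n]$.
   Context: For $i\in[n]$ the cyclic order $<_i$ is $i<_i i+1<_i\cdots<_i n<_i 1<_i\cdots<_i i-1$. A decorated permutation on $[n]$ is a pair $(\pi,\operatorname{col})$, $\pi$ a permutation of $[n]$, $\operatorname{col}:[n]\to\{0,1,-1\}$ with $\operatorname{col}(i)=0$ iff $\pi(i)\ne i$. Its Grassmann necklace is $I_i=\{j: j<_i\pi^{ -1}(j)\text{ or }\operatorname{col}(j)=-1\}$; its rank $\operatorname{rk}(\pi^{:})$ is $|I_1|$. For $a,b\in[n]$ the cyclic interval $(a,b]$ is $\{a+1,\dots,b\}$ (indices mod $n$), with $(a,a]=\emptyset$. Grassmann interval: $S^{\pi}_i=(\pi^{ -1}(i),i]$, except $S^{\pi}_i=[n]$ when $\pi(i)=i$ and $\operatorname{col}(i)=-1$. Shift interval: $S^{\pi,\sigma}_i=(\pi^{ -1}(i),\sigma^{ -1}(i)]$, except $S^{\pi,\sigma}_i=[n]$ when $i$ is a loop of $\sigma^{:}$ ($\sigma(i)=i$, $\operatorname{col}_\sigma(i)=1$) and a coloop of $\pi^{:}$ ($\pi(i)=i$,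 $\operatorname{col}_\pi(i)=-1$). -}

module Defs where

open import Data.Nat using (ℕ; zero; suc; _+_; _∸_; _≤_; _<_; _≤ᵇ_; _<ᵇ_)
open import Data.Bool using (Bool; true; false; _∧_; _∨_; not; if_then_else_)
open import Data.Fin using (Fin; toℕ; _≟_)
open import Data.Fin.Permutation using (Permutation′; _⟨$⟩ʳ_; _⟨$⟩ˡ_)
open import Data.List using (List; []; _∷_)
open import Data.List.Base using (allFin)
open import Data.Product using (_×_)
open import Relation.Binary.PropositionalEquality using (_≡_)
open import Relation.Nullary using (¬_; does)

data Col : Set where
  c0 c1 c-1 : Col

isMinus : Col → Bool
isMinus c-1 = true
isMinus _   = false

isPlus : Col → Bool
isPlus c1 = true
isPlus _  = false

-- elements of [n] are Fin n; element k ∈ [n] is the Fin with toℕ = k - 1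
record DecoratedPerm (n : ℕ) : Set where
  field
    perm  : Permutation′ n
    col   : Fin n → Col
    colOk : ∀ i → (col i ≡ c0 → ¬ (perm ⟨$⟩ʳ i ≡ i)) × (¬ (perm ⟨$⟩ʳ i ≡ i) → col i ≡ c0)

open DecoratedPerm public

count : {A : Set} → (A → Bool) → List A → ℕ
count f [] = 0
count f (x ∷ xs) = (if f x then 1 else 0) + count f xs

module _ {n : ℕ} where

  π→ : DecoratedPerm n → Fin n → Fin n
  π→ p i = perm p ⟨$⟩ʳ i

  π← : DecoratedPerm n → Fin n → Fin n
  π← p i = perm p ⟨$⟩ˡ i

  -- cyclic distance from a to j, i.e. position of j in the order <_a (0 for j = a)
  rel : Fin n → Fin n → ℕ
  rel a j = if toℕ a ≤ᵇ toℕ j then toℕ j ∸ toℕ a else (n + toℕ j) ∸ toℕ a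

  cycLt : Fin n → Fin n → Fin n → Bool
  cycLt i j k = rel i j <ᵇ rel i k

  -- membership j ∈ (a, b]  (cyclic interval a+1, ..., b; empty when a = b)
  inCyc : Fin n → Fin n → Fin n → Bool
  inCyc a b j = (0 <ᵇ rel a j) ∧ (rel a j ≤ᵇ rel a b)

  inNecklace : DecoratedPerm n → Fin n → Fin n → Bool
  inNecklace p i j = cycLt i j (π← p j) ∨ isMinus (col p j)

  -- rk = |I_1| ; the element 1 ∈ [n] has toℕ = 0, so the order <_1 is the
  -- usual order on toℕ
  rk : DecoratedPerm n → ℕ
  rk p = count (λ j → (toℕ j <ᵇ toℕ (π← p j)) ∨ isMinus (col p j)) (allFin n)

  isFixed : DecoratedPerm n → Fin n → Bool
  isFixed p i = does (π→ p i ≟ i)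

  isColoop : DecoratedPerm n → Fin n → Bool
  isColoop p i = isFixed p i ∧ isMinus (col p i)

  isLoop : DecoratedPerm n → Fin n → Bool
  isLoop p i = isFixed p i ∧ isPlus (col p i)

  inS : DecoratedPerm n → Fin n → Fin n → Bool
  inS p i j = if isColoop p i then true else inCyc (π← p i) i j

  inShift : DecoratedPerm n → DecoratedPerm n → Fin n → Fin n → Bool
  inShift π σ i j =
    if isLoop σ i ∧ isColoop π i then true else inCyc (π← π i) (π← σ i) j

module Submission where

-- Fix j and count the intervals containing it. For Grassmann intervals, j ∈ S^π_i iff i ∈ I_j, and
-- the count is the same for every j: passing from j to j+1, the interval (π⁻¹(i), i] gains j+1 when
-- π⁻¹(i) = j and loses j when i = j, and if π moves j each of these happens for exactly one i.
-- Hence every j lies in exactly rk(π) Grassmann intervals of π.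
-- For each i, concatenating (π⁻¹(i), σ⁻¹(i)] and (σ⁻¹(i), i] gives S^{π,σ}_i ⊔ S^σ_i = S^π_i ⊔ e_i·[n],
-- where e_i ∈ {0, 1} records whether the concatenation wraps around. Summing over i, every j lies in
-- exactly rk(π) − rk(σ) + Σ e_i = 1 + Σ e_i shift intervals, so the shift intervals partition [n]
-- iff all e_i vanish, and e_i = 0 is equivalent to S^σ_i ⊆ S^π_i.

open import Defs
open import Data.Nat using (ℕ; suc)
open import Data.Fin using (Fin)
open import Data.Bool using (true)
open import Data.Product using (_×_; ∃)
open import Relation.Binary.PropositionalEquality using (_≡_)
open import Function.Bundles using (_⇔_)

open import Data.Bool using (Bool; false; _∧_; _∨_; not; if_then_else_)
open import Data.Bool.Properties using (∧-zeroʳ; ∧-identityʳ; ∧-conicalˡ; ∨-zeroʳ; ∨-identityʳ; ¬-not)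
import Data.Bool.Properties as Bool
open import Data.Empty using (⊥-elim)
open import Data.Fin using (zero; suc; toℕ; inject₁; _≟_)
open import Data.Fin.Permutation using (inverseˡ; inverseʳ)
open import Data.Fin.Properties using (toℕ<n; toℕ-injective; toℕ-inject₁; ¬∀⟶∃¬)
open import Data.List using (tabulate)
open import Data.Nat using (zero; _+_; _∸_; _≤_; _<_; _≤ᵇ_; _<ᵇ_; z≤n; s≤s; z<s)
open import Data.Nat.Properties hiding (_≟_)
open import Algebra.Properties.CommutativeMonoid.Sum +-0-commutativeMonoid
  using (sum; sum-cong-≗; ∑-distrib-+; sum-replicate-zero)
open import Data.Product using (_,_; proj₁; proj₂)
open import Data.Sum using (inj₁; inj₂)
open import Function using (_∘_)
open import Function.Bundles using (Equivalence; mk⇔)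
open import Relation.Binary.PropositionalEquality
open import Relation.Nullary using (yes; no; does)
open import Relation.Nullary.Decidable using (dec-true; dec-false; does-⇔)

𝟙 : Bool → ℕ
𝟙 b = if b then 1 else 0

≤ᵇ-true : ∀ {m n} → m ≤ n → (m ≤ᵇ n) ≡ true
≤ᵇ-true = dec-true (_ ≤? _)

≤ᵇ-false : ∀ {m n} → n < m → (m ≤ᵇ n) ≡ false
≤ᵇ-false n<m = dec-false (_ ≤? _) (<⇒≱ n<m)

<ᵇ-true : ∀ {m n} → m < n → (m <ᵇ n) ≡ true
<ᵇ-true = dec-true (_ <? _)

<ᵇ-false : ∀ {m n} → n ≤ m → (m <ᵇ n) ≡ false
<ᵇ-false n≤m = dec-false (_ <? _) (≤⇒≯ n≤m)

𝟙+1≡𝟙⇒true : ∀ {a b} → 𝟙 a + 1 ≡ 𝟙 b + 0 → b ≡ true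
𝟙+1≡𝟙⇒true {b = true} _ = refl
𝟙+1≡𝟙⇒true {false} {false} ()
𝟙+1≡𝟙⇒true {true} {false} ()

count-tabulate : ∀ {A : Set} {n} (f : A → Bool) (g : Fin n → A) →
  count f (tabulate g) ≡ sum (λ i → 𝟙 (f (g i)))
count-tabulate {n = zero} f g = refl
count-tabulate {n = suc n} f g = cong (𝟙 (f (g zero)) +_) (count-tabulate f (g ∘ suc))

sum-zero : ∀ {n} {f : Fin n → ℕ} → (∀ i → f i ≡ 0) → sum f ≡ 0
sum-zero {n} f≡0 = trans (sum-cong-≗ f≡0) (sum-replicate-zero n)

sum≡0⇒ : ∀ {n} (f : Fin n → ℕ) → sum f ≡ 0 → ∀ i → f i ≡ 0
sum≡0⇒ f Σ≡0 zero = m+n≡0⇒m≡0 (f zero) Σ≡0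
sum≡0⇒ f Σ≡0 (suc i) = sum≡0⇒ (f ∘ suc) (m+n≡0⇒n≡0 (f zero) Σ≡0) i

sum-mono-≤ : ∀ {n} {f g : Fin n → ℕ} → (∀ i → f i ≤ g i) → sum f ≤ sum g
sum-mono-≤ {zero} _ = z≤n
sum-mono-≤ {suc n} f≤g = +-mono-≤ (f≤g zero) (sum-mono-≤ (f≤g ∘ suc))

sum-𝟙-point : ∀ {n} (b : Fin n → Bool) (k : Fin n) → sum (λ i → 𝟙 (b i ∧ does (i ≟ k))) ≡ 𝟙 (b k)
sum-𝟙-point {suc n} b zero = trans (cong₂ _+_ (cong 𝟙 (∧-identityʳ (b zero)))
  (sum-zero (λ i → cong 𝟙 (∧-zeroʳ (b (suc i)))))) (+-identityʳ _)
sum-𝟙-point {suc n} b (suc k) = cong₂ _+_ (cong 𝟙 (∧-zeroʳ (b zero))) (sum-𝟙-point (b ∘ suc) k)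

sum-𝟙-≟ : ∀ {n} (k : Fin n) → sum (λ i → 𝟙 (does (i ≟ k))) ≡ 1
sum-𝟙-≟ = sum-𝟙-point (λ _ → true)

ExactlyOne : ∀ {n} → (Fin n → Bool) → Set
ExactlyOne g = (∃ λ i → g i ≡ true) × (∀ i i′ → g i ≡ true → g i′ ≡ true → i ≡ i′)

sum-𝟙≡1⇔ExactlyOne : ∀ {n} (g : Fin n → Bool) → sum (λ i → 𝟙 (g i)) ≡ 1 ⇔ ExactlyOne g
sum-𝟙≡1⇔ExactlyOne {n} g =
  mk⇔ (λ Σ≡1 → witness Σ≡1 , unique Σ≡1) (λ ((w , g-w) , u) → count-one w g-w u)
  where
    witness : sum (λ i → 𝟙 (g i)) ≡ 1 → ∃ λ i → g i ≡ true
    witness Σ≡1 with ¬∀⟶∃¬ n (λ i → g i ≡ false) (λ i → g i Bool.≟ false)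
                        (λ none → 1+n≢0 (trans (sym Σ≡1) (sum-zero (λ i → cong 𝟙 (none i)))))
    ... | i , gᵢ≢false = i , ¬-not gᵢ≢false

    unique : sum (λ i → 𝟙 (g i)) ≡ 1 → ∀ i i′ → g i ≡ true → g i′ ≡ true → i ≡ i′
    unique Σ≡1 i i′ gᵢ gᵢ′ with i ≟ i′
    ... | yes i≡i′ = i≡i′
    ... | no i≢i′ = ⊥-elim (<⇒≱ (s≤s (s≤s z≤n)) (begin
      2                                      ≡⟨ cong₂ _+_ (sym (sum-𝟙-≟ i)) (sym (sum-𝟙-≟ i′)) ⟩
      sum at-i + sum at-i′                   ≡⟨ ∑-distrib-+ at-i at-i′ ⟨
      sum (λ k → at-i k + at-i′ k)           ≤⟨ sum-mono-≤ two-points ⟩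
      sum (λ k → 𝟙 (g k))                    ≡⟨ Σ≡1 ⟩
      1                                      ∎))
      where
        open ≤-Reasoning
        at-i at-i′ : Fin n → ℕ
        at-i k = 𝟙 (does (k ≟ i))
        at-i′ k = 𝟙 (does (k ≟ i′))
        two-points : ∀ k → 𝟙 (does (k ≟ i)) + 𝟙 (does (k ≟ i′)) ≤ 𝟙 (g k)
        two-points k with k ≟ i | k ≟ i′
        ... | yes refl | yes refl = ⊥-elim (i≢i′ refl)
        ... | yes refl | no _ rewrite gᵢ = ≤-refl
        ... | no _ | yes refl rewrite gᵢ′ = ≤-refl
        ... | no _ | no _ = z≤n

    count-one : ∀ w → g w ≡ true → (∀ i i′ → g i ≡ true → g i′ ≡ true → i ≡ i′) →
                sum (λ i → 𝟙 (g i)) ≡ 1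
    count-one w g-w u = trans (sum-cong-≗ (λ k → cong 𝟙 (indicator k))) (sum-𝟙-≟ w)
      where
        indicator : ∀ k → g k ≡ does (k ≟ w)
        indicator k with k ≟ w
        ... | yes refl = g-w
        ... | no k≢w with g k in g-k
        ...   | false = refl
        ...   | true = ⊥-elim (k≢w (u k w g-k g-w))

constant-if-suc-invariant : ∀ {A : Set} {n} (f : Fin (suc n) → A) →
  (∀ {j j′} → toℕ j′ ≡ suc (toℕ j) → f j ≡ f j′) → ∀ j → f j ≡ f zero
constant-if-suc-invariant f step zero = refl
constant-if-suc-invariant {n = suc n} f step (suc j) =
  trans (sym (step {inject₁ j} (cong suc (sym (toℕ-inject₁ j)))))
        (constant-if-suc-invariant (f ∘ inject₁) step′ j)
  where
    step′ : ∀ {j j′} → toℕ j′ ≡ suc (toℕ j) → f (inject₁ j) ≡ f (inject₁ j′)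
    step′ {j} {j′} j′≡ = step (trans (toℕ-inject₁ j′) (trans j′≡ (cong suc (sym (toℕ-inject₁ j)))))

-- `δ a j` is the position of j in the cyclic order <_a on {0, …, n−1}: Defs' `rel a j` and
-- `inCyc a b j` unfold to `δ (toℕ a) (toℕ j)` and `rel a j ∈⟨0, rel a b ]`.
module CyclicArithmetic (n : ℕ) where

  δ : ℕ → ℕ → ℕ
  δ a j = if a ≤ᵇ j then j ∸ a else n + j ∸ a

  _∈⟨0,_] : ℕ → ℕ → Bool
  r ∈⟨0, b ] = (0 <ᵇ r) ∧ (r ≤ᵇ b)

  private
    <n+ : ∀ {p} r → p < n → p < n + r
    <n+ r p<n = <-≤-trans p<n (m≤m+n n r)

  δ-≤ : ∀ {a j} → a ≤ j → δ a j ≡ j ∸ a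
  δ-≤ a≤j rewrite ≤ᵇ-true a≤j = refl

  δ-> : ∀ {a j} → j < a → δ a j ≡ n + j ∸ a
  δ-> j<a rewrite ≤ᵇ-false j<a = refl

  δ-self : ∀ a → δ a a ≡ 0
  δ-self a = trans (δ-≤ {a} ≤-refl) (n∸n≡0 a)

  δ-< : ∀ {a j} → a < n → j < n → δ a j < n
  δ-< {a} {j} a<n j<n with a ≤? j
  ... | yes a≤j rewrite δ-≤ a≤j = ≤-<-trans (m∸n≤m j a) j<n
  ... | no a≰j rewrite δ-> (≰⇒> a≰j) =
    subst (n + j ∸ a <_) (m+n∸n≡m n a)
      (∸-monoˡ-< (+-monoʳ-< n (≰⇒> a≰j)) (<⇒≤ (<n+ j a<n)))

  δ≡0⇒≡ : ∀ {a j} → a < n → δ a j ≡ 0 → j ≡ a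
  δ≡0⇒≡ {a} {j} a<n δ≡0 with a ≤? j
  ... | yes a≤j = ≤-antisym (m∸n≡0⇒m≤n (trans (sym (δ-≤ a≤j)) δ≡0)) a≤j
  ... | no a≰j = ⊥-elim (<⇒≱ a<n
         (≤-trans (m≤m+n n j) (m∸n≡0⇒m≤n (trans (sym (δ-> (≰⇒> a≰j))) δ≡0))))

  private
    ∸-∸-cancel : ∀ z {x y} → x ≤ y → (z ∸ x) ∸ (y ∸ x) ≡ z ∸ y
    ∸-∸-cancel z {x} x≤y = trans (∸-+-assoc z x _) (cong (z ∸_) (m+[n∸m]≡n x≤y))

    +-∸-cancel : ∀ z {x y} → x ≤ n + y → (n + z ∸ x) ∸ (n + y ∸ x) ≡ z ∸ y
    +-∸-cancel z {x} {y} x≤n+y = trans (∸-∸-cancel (n + z) x≤n+y) ([m+n]∸[m+o]≡n∸o n z y)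

  δ-rotate : ∀ {x y j} → x < n → y < n → j < n → δ y j ≡ δ (δ x y) (δ x j)
  δ-rotate {x} {y} {j} x<n y<n j<n with x ≤? y | x ≤? j | y ≤? j
  ... | yes x≤y | yes x≤j | yes y≤j
    rewrite δ-≤ y≤j | δ-≤ x≤y | δ-≤ x≤j | δ-≤ (∸-monoˡ-≤ x y≤j) = sym (∸-∸-cancel j x≤y)
  ... | yes x≤y | yes x≤j | no y≰j
    rewrite δ-> (≰⇒> y≰j) | δ-≤ x≤y | δ-≤ x≤j | δ-> (∸-monoˡ-< (≰⇒> y≰j) x≤j)
          | sym (+-∸-assoc n x≤j) = sym (∸-∸-cancel (n + j) x≤y)
  ... | yes x≤y | no x≰j | yes y≤j = ⊥-elim (x≰j (≤-trans x≤y y≤j))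
  ... | yes x≤y | no x≰j | no _
    rewrite δ-> (<-≤-trans (≰⇒> x≰j) x≤y) | δ-≤ x≤y | δ-> (≰⇒> x≰j)
          | δ-≤ (∸-monoˡ-≤ x (<⇒≤ (<n+ j y<n))) = sym (∸-∸-cancel (n + j) x≤y)
  ... | no x≰y | yes x≤j | _
    rewrite δ-≤ (≤-trans (<⇒≤ (≰⇒> x≰y)) x≤j) | δ-> (≰⇒> x≰y) | δ-≤ x≤j
          | δ-> (∸-monoˡ-< (<n+ y j<n) x≤j) | sym (+-∸-assoc n x≤j) = sym (+-∸-cancel j (<⇒≤ (<n+ y x<n)))
  ... | no x≰y | no x≰j | yes y≤j
    rewrite δ-≤ y≤j | δ-> (≰⇒> x≰y) | δ-> (≰⇒> x≰j)
          | δ-≤ (∸-monoˡ-≤ x (+-monoʳ-≤ n y≤j)) = sym (+-∸-cancel j (<⇒≤ (<n+ y x<n)))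
  ... | no x≰y | no x≰j | no y≰j
    rewrite δ-> (≰⇒> y≰j) | δ-> (≰⇒> x≰y) | δ-> (≰⇒> x≰j)
          | δ-> (∸-monoˡ-< (+-monoʳ-< n (≰⇒> y≰j)) (<⇒≤ (<n+ j x<n)))
          | sym (+-∸-assoc n {n + j} (<⇒≤ (<n+ j x<n))) = sym (+-∸-cancel (n + j) (<⇒≤ (<n+ y x<n)))

  δ-injective : ∀ {a i j} → a < n → i < n → j < n → δ a i ≡ δ a j → i ≡ j
  δ-injective {a} {i} {j} a<n i<n j<n eq = sym (δ≡0⇒≡ i<n (begin
    δ i j                 ≡⟨ δ-rotate a<n i<n j<n ⟩
    δ (δ a i) (δ a j)     ≡⟨ cong (λ d → δ d (δ a j)) eq ⟩
    δ (δ a j) (δ a j)     ≡⟨ δ-self (δ a j) ⟩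
    0                     ∎))
    where open ≡-Reasoning

  δ-suc : ∀ {a j} → a < n → suc j ≢ a → δ a (suc j) ≡ suc (δ a j)
  δ-suc {a} {j} a<n sj≢a with a ≤? j
  ... | yes a≤j rewrite δ-≤ (m≤n⇒m≤1+n a≤j) | δ-≤ a≤j = +-∸-assoc 1 a≤j
  ... | no a≰j rewrite δ-> (≤∧≢⇒< (≰⇒> a≰j) sj≢a) | δ-> (≰⇒> a≰j) | +-suc n j
    = +-∸-assoc 1 (<⇒≤ (<n+ j a<n))

  δ-suc-self : ∀ {j} → suc j < n → suc (δ (suc j) j) ≡ n
  δ-suc-self {j} sj<n rewrite δ-> (n<1+n j) =
    trans (sym (+-∸-assoc 1 (≤-trans (<⇒≤ sj<n) (m≤m+n n j)))) (m+n∸n≡m n j)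

  private
    ∸-≤ᵇ : ∀ {p x y} → p ≤ x → p ≤ y → (x ∸ p ≤ᵇ y ∸ p) ≡ (x ≤ᵇ y)
    ∸-≤ᵇ {p} {x} {y} p≤x p≤y = does-⇔ (mk⇔ cancel (∸-monoˡ-≤ p)) (_ ≤? _) (_ ≤? _)
      where
        cancel : x ∸ p ≤ y ∸ p → x ≤ y
        cancel h = subst₂ _≤_ (m∸n+n≡m p≤x) (m∸n+n≡m p≤y) (+-monoˡ-≤ p h)

    0<ᵇ∸ : ∀ {p x} → p ≤ x → (0 <ᵇ x ∸ p) ≡ (p <ᵇ x)
    0<ᵇ∸ {p} {x} _ = does-⇔ (mk⇔ (λ h → m∸n≢0⇒n<m (>⇒≢ h)) m<n⇒0<n∸m) (0 <? x ∸ p) (p <? x)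

    +-≤ᵇ : ∀ {r q} → (n + r ≤ᵇ n + q) ≡ (r ≤ᵇ q)
    +-≤ᵇ = does-⇔ (mk⇔ (+-cancelˡ-≤ n _ _) (+-monoʳ-≤ n)) (_ ≤? _) (_ ≤? _)

  -- (0, p] ⊔ (p, q] = (0, q] ⊔ ([0, n) if q < p), with (p, q] read in coordinates based at p.
  ∈⟨0,⟩-concat : ∀ {p q r} → p < n → q < n → r < n →
    𝟙 (r ∈⟨0, p ]) + 𝟙 (δ p r ∈⟨0, δ p q ]) ≡ 𝟙 (r ∈⟨0, q ]) + 𝟙 (q <ᵇ p)
  ∈⟨0,⟩-concat {p} {q} {r} p<n q<n r<n with p ≤? r | p ≤? q
  ... | yes p≤r | yes p≤q with m≤n⇒m<n∨m≡n p≤r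
  ...   | inj₁ p<r rewrite δ-≤ p≤r | δ-≤ p≤q | 0<ᵇ∸ p≤r | ∸-≤ᵇ p≤r p≤q | <ᵇ-false p≤q
           | <ᵇ-true p<r | ≤ᵇ-false p<r | <ᵇ-true (≤-<-trans z≤n p<r) = sym (+-identityʳ _)
  ...   | inj₂ refl rewrite δ-≤ p≤r | δ-≤ p≤q | 0<ᵇ∸ p≤r | ∸-≤ᵇ p≤r p≤q | <ᵇ-false p≤q
           | ≤ᵇ-true (≤-refl {p}) | <ᵇ-false (≤-refl {p}) | ≤ᵇ-true p≤q = refl
  ∈⟨0,⟩-concat {p} {q} {r} p<n q<n r<n | yes p≤r | no p≰q with m≤n⇒m<n∨m≡n p≤r
  ... | inj₁ p<r rewrite δ-≤ p≤r | δ-> (≰⇒> p≰q) | 0<ᵇ∸ p≤r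
           | ∸-≤ᵇ p≤r (<⇒≤ (<n+ q p<n)) | <ᵇ-true (≰⇒> p≰q) | ≤ᵇ-false (<-≤-trans (≰⇒> p≰q) p≤r)
           | ≤ᵇ-true (<⇒≤ (<n+ q r<n)) | ≤ᵇ-false p<r | <ᵇ-true p<r | ∧-zeroʳ (0 <ᵇ r) = refl
  ... | inj₂ refl rewrite δ-≤ p≤r | δ-> (≰⇒> p≰q) | 0<ᵇ∸ p≤r | ∸-≤ᵇ p≤r (<⇒≤ (<n+ q p<n))
           | <ᵇ-true (≰⇒> p≰q) | ≤ᵇ-false (≰⇒> p≰q) | ∧-zeroʳ (0 <ᵇ p) | ≤ᵇ-true (<⇒≤ (<n+ q p<n))
           | ≤ᵇ-true (≤-refl {p}) | <ᵇ-false (≤-refl {p}) | <ᵇ-true (≤-<-trans z≤n (≰⇒> p≰q)) = refl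
  ∈⟨0,⟩-concat {p} {q} {r} p<n q<n r<n | no p≰r | yes p≤q
    rewrite δ-> (≰⇒> p≰r) | δ-≤ p≤q | 0<ᵇ∸ (<⇒≤ (<n+ r p<n))
          | ∸-≤ᵇ (<⇒≤ (<n+ r p<n)) p≤q | <ᵇ-false p≤q | ≤ᵇ-true (<⇒≤ (≰⇒> p≰r)) | <ᵇ-true (<n+ r p<n)
          | ≤ᵇ-false (<n+ r q<n) | ≤ᵇ-true (≤-trans (<⇒≤ (≰⇒> p≰r)) p≤q) = refl
  ∈⟨0,⟩-concat {p} {q} {r} p<n q<n r<n | no p≰r | no p≰q
    rewrite δ-> (≰⇒> p≰r) | δ-> (≰⇒> p≰q) | 0<ᵇ∸ (<⇒≤ (<n+ r p<n))
          | ∸-≤ᵇ (<⇒≤ (<n+ r p<n)) (<⇒≤ (<n+ q p<n)) | <ᵇ-true (≰⇒> p≰q) | ≤ᵇ-true (<⇒≤ (≰⇒> p≰r))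
          | <ᵇ-true (<n+ r p<n) | +-≤ᵇ {r} {q} = ∈⟨0,⟩-wrap r q
    where
      ∈⟨0,⟩-wrap : ∀ r q → 𝟙 ((0 <ᵇ r) ∧ true) + 𝟙 (r ≤ᵇ q) ≡ 𝟙 (r ∈⟨0, q ]) + 1
      ∈⟨0,⟩-wrap zero q = refl
      ∈⟨0,⟩-wrap (suc r) q = +-comm 1 (𝟙 (r <ᵇ q))

  zero-∈⟨0,⟩ : ∀ {a b} → a < n → b < n → δ a 0 ∈⟨0, δ a b ] ≡ (b <ᵇ a)
  zero-∈⟨0,⟩ {zero} a<n b<n = refl
  zero-∈⟨0,⟩ {suc a} {b} a<n b<n with suc a ≤? b
  ... | yes a<b rewrite δ-> {suc a} {0} z<s | δ-≤ a<b | 0<ᵇ∸ (<⇒≤ (<n+ 0 a<n)) | <ᵇ-true (<n+ 0 a<n)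
        | ∸-≤ᵇ (<⇒≤ (<n+ 0 a<n)) a<b | ≤ᵇ-false (<n+ 0 b<n) | <ᵇ-false a<b = refl
  ... | no a≮b rewrite δ-> {suc a} {0} z<s | δ-> (≰⇒> a≮b) | 0<ᵇ∸ (<⇒≤ (<n+ 0 a<n))
        | <ᵇ-true (<n+ 0 a<n) | ∸-≤ᵇ (<⇒≤ (<n+ 0 a<n)) (<⇒≤ (<n+ b a<n)) | +-≤ᵇ {0} {b}
        | <ᵇ-true (≰⇒> a≮b) = refl

  ∈⟨0,0] : ∀ r → r ∈⟨0, 0 ] ≡ false
  ∈⟨0,0] zero = refl
  ∈⟨0,0] (suc r) = refl

module _ {n : ℕ} where
  open CyclicArithmetic n

  private
    rel-pos : ∀ {a j : Fin n} → a ≢ j → 0 < rel a j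
    rel-pos {a} {j} a≢j = n≢0⇒n>0 (λ e → a≢j (sym (toℕ-injective (δ≡0⇒≡ (toℕ<n a) e))))

    rel-< : ∀ (a j : Fin n) → rel a j < n
    rel-< a j = δ-< (toℕ<n a) (toℕ<n j)

    rel-injective : ∀ {a i j : Fin n} → rel a i ≡ rel a j → i ≡ j
    rel-injective {a} {i} {j} eq = toℕ-injective (δ-injective (toℕ<n a) (toℕ<n i) (toℕ<n j) eq)

    rel-suc : ∀ {a j j′ : Fin n} → toℕ j′ ≡ suc (toℕ j) → j′ ≢ a → rel a j′ ≡ suc (rel a j)
    rel-suc {a} j′≡ j′≢a rewrite j′≡ =
      δ-suc (toℕ<n a) (λ e → j′≢a (toℕ-injective (trans j′≡ e)))

    rel-wrap : ∀ {j j′ : Fin n} → toℕ j′ ≡ suc (toℕ j) → suc (rel j′ j) ≡ n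
    rel-wrap {j} {j′} j′≡ = subst (λ t → suc (δ t (toℕ j)) ≡ n) (sym j′≡)
      (δ-suc-self (subst (_< n) j′≡ (toℕ<n j′)))

    suc≢ : ∀ {j j′ : Fin n} → toℕ j′ ≡ suc (toℕ j) → j′ ≢ j
    suc≢ j′≡ e = 1+n≢n (trans (sym j′≡) (cong toℕ e))

  inCyc-empty : ∀ (a j : Fin n) → inCyc a a j ≡ false
  inCyc-empty a j rewrite δ-self (toℕ a) = ∈⟨0,0] (rel a j)

  inCyc-left-end : ∀ (a b : Fin n) → inCyc a b a ≡ false
  inCyc-left-end a b rewrite δ-self (toℕ a) = refl

  inCyc-right-end : ∀ {a b : Fin n} → a ≢ b → inCyc a b b ≡ true
  inCyc-right-end {a} {b} a≢b rewrite <ᵇ-true (rel-pos a≢b) | ≤ᵇ-true (≤-refl {rel a b}) = refl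

  inCyc≡cycLt : ∀ (a b j : Fin n) → inCyc a b j ≡ cycLt j b a
  inCyc≡cycLt a b j = begin
    δ (toℕ a) (toℕ j) ∈⟨0, rel a b ]
      ≡⟨ cong₂ _∈⟨0,_] (δ-rotate (toℕ<n j) (toℕ<n a) (toℕ<n j)) (δ-rotate (toℕ<n j) (toℕ<n a) (toℕ<n b)) ⟩
    δ (rel j a) (rel j j) ∈⟨0, δ (rel j a) (rel j b) ]
      ≡⟨ cong (λ r → δ (rel j a) r ∈⟨0, δ (rel j a) (rel j b) ]) (δ-self (toℕ j)) ⟩
    δ (rel j a) 0 ∈⟨0, δ (rel j a) (rel j b) ]
      ≡⟨ zero-∈⟨0,⟩ (rel-< j a) (rel-< j b) ⟩
    cycLt j b a ∎
    where open ≡-Reasoning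

  inCyc-concat : ∀ (x y z j : Fin n) →
    𝟙 (inCyc x y j) + 𝟙 (inCyc y z j) ≡ 𝟙 (inCyc x z j) + 𝟙 (inCyc y z x)
  inCyc-concat x y z j = begin
    𝟙 (inCyc x y j) + 𝟙 (inCyc y z j)
      ≡⟨ cong (λ b → 𝟙 (inCyc x y j) + 𝟙 b) (cong₂ _∈⟨0,_] (rotate j) (rotate z)) ⟩
    𝟙 (rel x j ∈⟨0, rel x y ]) + 𝟙 (δ (rel x y) (rel x j) ∈⟨0, δ (rel x y) (rel x z) ])
      ≡⟨ ∈⟨0,⟩-concat (rel-< x y) (rel-< x z) (rel-< x j) ⟩
    𝟙 (inCyc x z j) + 𝟙 (cycLt x z y)
      ≡⟨ cong (λ b → 𝟙 (inCyc x z j) + 𝟙 b) (inCyc≡cycLt y z x) ⟨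
    𝟙 (inCyc x z j) + 𝟙 (inCyc y z x) ∎
    where
      open ≡-Reasoning
      rotate : ∀ t → rel y t ≡ δ (rel x y) (rel x t)
      rotate t = δ-rotate (toℕ<n x) (toℕ<n y) (toℕ<n t)

  inCyc-suc : ∀ (a b : Fin n) {j j′} → toℕ j′ ≡ suc (toℕ j) →
    𝟙 (inCyc a b j) + 𝟙 (not (does (a ≟ b)) ∧ does (a ≟ j)) ≡
    𝟙 (inCyc a b j′) + 𝟙 (not (does (a ≟ b)) ∧ does (b ≟ j))
  inCyc-suc a b {j} {j′} j′≡ with a ≟ b
  ... | yes refl rewrite inCyc-empty a j | inCyc-empty a j′ = refl
  ... | no a≢b with a ≟ j | b ≟ j
  ...   | yes refl | yes refl = ⊥-elim (a≢b refl)
  ...   | yes refl | no _ rewrite inCyc-left-end a b | rel-suc {a} j′≡ (suc≢ j′≡) | δ-self (toℕ a)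
          | <ᵇ-true (rel-pos a≢b) = refl
  ...   | no a≢j | yes refl rewrite inCyc-right-end a≢b = cong (λ x → 𝟙 x + 1) (sym leaves)
    where
      leaves : inCyc a b j′ ≡ false
      leaves with j′ ≟ a
      ... | yes refl = inCyc-left-end j′ b
      ... | no j′≢a rewrite rel-suc {a} j′≡ j′≢a = <ᵇ-false (≤-refl {rel a b})
  ...   | no a≢j | no b≢j = cong (λ x → 𝟙 x + 0) stays
    where
      stays : inCyc a b j ≡ inCyc a b j′
      stays with j′ ≟ a
      ... | yes refl = trans (cong ((0 <ᵇ rel a j) ∧_) (≤ᵇ-false past))
                         (trans (∧-zeroʳ _) (sym (inCyc-left-end a b)))
        where
          past : rel a b < rel a j
          past = ≤∧≢⇒< (≤-pred (subst (rel a b <_) (sym (rel-wrap j′≡)) (rel-< a b)))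
                   (λ e → b≢j (rel-injective {a} e))
      ... | no j′≢a rewrite rel-suc {a} j′≡ j′≢a | <ᵇ-true (rel-pos a≢j) =
        does-⇔ (mk⇔ (λ r≤B → ≤∧≢⇒< r≤B (λ e → b≢j (rel-injective {a} (sym e)))) <⇒≤)
          (rel a j ≤? rel a b) (rel a j <? rel a b)

module _ {n : ℕ} (p : DecoratedPerm n) where

  π←≟ : ∀ i j → does (π← p i ≟ j) ≡ does (i ≟ π→ p j)
  π←≟ i j = does-⇔ (mk⇔ (λ e → trans (sym (inverseʳ (perm p))) (cong (π→ p) e))
                        (λ e → trans (cong (π← p) e) (inverseˡ (perm p))))
                   (π← p i ≟ j) (i ≟ π→ p j)

  private
    fixed : ∀ {i} → isFixed p i ≡ true → π← p i ≡ i
    fixed {i} fix with π→ p i ≟ i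
    ... | yes πi≡i = trans (cong (π← p) (sym πi≡i)) (inverseˡ (perm p))

  coloop⇒fixed : ∀ {i} → isColoop p i ≡ true → π← p i ≡ i
  coloop⇒fixed {i} c = fixed (∧-conicalˡ _ _ c)

  loop⇒fixed : ∀ {i} → isLoop p i ≡ true → π← p i ≡ i
  loop⇒fixed {i} l = fixed (∧-conicalˡ _ _ l)

  loop⇒¬coloop : ∀ {i} → isLoop p i ≡ true → isColoop p i ≡ false
  loop⇒¬coloop {i} l with isFixed p i | col p i
  ... | false | _  = refl
  ... | true  | c1 = refl

  ¬loop∧¬coloop⇒moved : ∀ {i} → isLoop p i ≡ false → isColoop p i ≡ false → π← p i ≢ i
  ¬loop∧¬coloop⇒moved {i} l c π←i≡i with π→ p i ≟ i | col p i in colᵢ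
  ... | no πi≢i | _ = πi≢i (trans (cong (π→ p) (sym π←i≡i)) (inverseʳ (perm p)))
  ... | yes πi≡i | c0 = proj₁ (colOk p i) colᵢ πi≡i

  minus≡coloop : ∀ i → isMinus (col p i) ≡ isColoop p i
  minus≡coloop i with π→ p i ≟ i | col p i in colᵢ
  ... | yes _ | _ = refl
  ... | no _ | c0 = refl
  ... | no _ | c1 = refl
  ... | no πi≢i | c-1 with () ← trans (sym colᵢ) (proj₂ (colOk p i) πi≢i)

  moves : Fin n → Bool
  moves i = not (does (π← p i ≟ i))

  inS-suc : ∀ i {j j′} → toℕ j′ ≡ suc (toℕ j) →
    𝟙 (inS p i j) + 𝟙 (moves i ∧ does (π← p i ≟ j)) ≡ 𝟙 (inS p i j′) + 𝟙 (moves i ∧ does (i ≟ j))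
  inS-suc i j′≡ with isColoop p i in c
  ... | true rewrite dec-true (π← p i ≟ i) (coloop⇒fixed c) = refl
  ... | false = inCyc-suc (π← p i) i j′≡

  sum-moves∧π←≟ : ∀ j → sum (λ i → 𝟙 (moves i ∧ does (π← p i ≟ j))) ≡ 𝟙 (moves j)
  sum-moves∧π←≟ j = begin
    sum (λ i → 𝟙 (moves i ∧ does (π← p i ≟ j)))
      ≡⟨ sum-cong-≗ (λ i → cong (λ b → 𝟙 (moves i ∧ b)) (π←≟ i j)) ⟩
    sum (λ i → 𝟙 (moves i ∧ does (i ≟ π→ p j)))
      ≡⟨ sum-𝟙-point moves (π→ p j) ⟩
    𝟙 (not (does (π← p (π→ p j) ≟ π→ p j)))
      ≡⟨ cong (λ k → 𝟙 (not (does (k ≟ π→ p j)))) (inverseˡ (perm p)) ⟩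
    𝟙 (not (does (j ≟ π→ p j)))
      ≡⟨ cong (𝟙 ∘ not) (π←≟ j j) ⟨
    𝟙 (moves j) ∎
    where open ≡-Reasoning

  multiplicity : Fin n → ℕ
  multiplicity j = sum (λ i → 𝟙 (inS p i j))

  multiplicity-suc : ∀ {j j′} → toℕ j′ ≡ suc (toℕ j) → multiplicity j ≡ multiplicity j′
  multiplicity-suc {j} {j′} j′≡ = +-cancelʳ-≡ (𝟙 (moves j)) _ _ (begin
    multiplicity j + 𝟙 (moves j)
      ≡⟨ cong (multiplicity j +_) (sum-moves∧π←≟ j) ⟨
    multiplicity j + sum (λ i → 𝟙 (moves i ∧ does (π← p i ≟ j)))
      ≡⟨ ∑-distrib-+ (λ i → 𝟙 (inS p i j)) _ ⟨
    sum (λ i → 𝟙 (inS p i j) + 𝟙 (moves i ∧ does (π← p i ≟ j)))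
      ≡⟨ sum-cong-≗ (λ i → inS-suc i j′≡) ⟩
    sum (λ i → 𝟙 (inS p i j′) + 𝟙 (moves i ∧ does (i ≟ j)))
      ≡⟨ ∑-distrib-+ (λ i → 𝟙 (inS p i j′)) _ ⟩
    multiplicity j′ + sum (λ i → 𝟙 (moves i ∧ does (i ≟ j)))
      ≡⟨ cong (multiplicity j′ +_) (sum-𝟙-point moves j) ⟩
    multiplicity j′ + 𝟙 (moves j) ∎)
    where open ≡-Reasoning

  inS≡inNecklace : ∀ i j → inS p i j ≡ inNecklace p j i
  inS≡inNecklace i j = trans by-coloop (cong (cycLt j i (π← p i) ∨_) (sym (minus≡coloop i)))
    where
      by-coloop : inS p i j ≡ cycLt j i (π← p i) ∨ isColoop p i
      by-coloop with isColoop p i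
      ... | true = sym (∨-zeroʳ _)
      ... | false = trans (inCyc≡cycLt (π← p i) i j) (sym (∨-identityʳ _))

-- `rk p` is `count (inNecklace p zero) (allFin n)` once `rel zero` is unfolded.
multiplicity≡rk : ∀ {n} (p : DecoratedPerm n) (j : Fin n) → multiplicity p j ≡ rk p
multiplicity≡rk {suc n} p j = begin
  multiplicity p j    ≡⟨ constant-if-suc-invariant (multiplicity p) (multiplicity-suc p) j ⟩
  multiplicity p zero ≡⟨ sum-cong-≗ (λ i → cong 𝟙 (inS≡inNecklace p i zero)) ⟩
  sum (λ i → 𝟙 (inNecklace p zero i)) ≡⟨ count-tabulate (inNecklace p zero) (λ i → i) ⟨
  rk p ∎
  where open ≡-Reasoning

module _ {n : ℕ} (π σ : DecoratedPerm n) where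

  -- By `inCyc-concat`, π⁻¹(i) ∈ S^σ_i exactly when (π⁻¹(i), σ⁻¹(i)] ⊔ (σ⁻¹(i), i] wraps around.
  excess : Fin n → ℕ
  excess i = if isColoop π i then 0 else 𝟙 (inS σ i (π← π i))

  inShift+inS : ∀ i j → 𝟙 (inShift π σ i j) + 𝟙 (inS σ i j) ≡ 𝟙 (inS π i j) + excess i
  inShift+inS i j with isColoop π i in πc
  ... | false rewrite ∧-zeroʳ (isLoop σ i) with isColoop σ i in σc
  ...   | true rewrite coloop⇒fixed σ σc = refl
  ...   | false = inCyc-concat (π← π i) (π← σ i) i j
  inShift+inS i j | true rewrite coloop⇒fixed π πc with isLoop σ i in σl
  ...   | true rewrite loop⇒¬coloop σ σl | loop⇒fixed σ σl | inCyc-empty i j = refl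
  ...   | false with isColoop σ i in σc
  ...     | true rewrite coloop⇒fixed σ σc | inCyc-empty i j = refl
  ...     | false = trans (inCyc-concat i (π← σ i) i j)
                      (cong₂ _+_ (cong 𝟙 (inCyc-empty i j))
                                 (cong 𝟙 (inCyc-right-end (¬loop∧¬coloop⇒moved σ σl σc))))

  excess≡0⇔⊆ : ∀ i → excess i ≡ 0 ⇔ (∀ j → inS σ i j ≡ true → inS π i j ≡ true)
  excess≡0⇔⊆ i = mk⇔ to from
    where
      to : excess i ≡ 0 → ∀ j → inS σ i j ≡ true → inS π i j ≡ true
      to e j s = 𝟙+1≡𝟙⇒true (subst₂ (λ b k → 𝟙 (inShift π σ i j) + 𝟙 b ≡ 𝟙 (inS π i j) + k)
                                    s e (inShift+inS i j))
      from : (∀ j → inS σ i j ≡ true → inS π i j ≡ true) → excess i ≡ 0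
      from ⊆ with isColoop π i in πc
      ... | true = refl
      ... | false with inS σ i (π← π i) in s
      ...   | false = refl
      ...   | true with () ← trans (sym (⊆ (π← π i) s)) (inCyc-left-end (π← π i) i)

  shift-multiplicity : suc (rk σ) ≡ rk π → ∀ j → sum (λ i → 𝟙 (inShift π σ i j)) ≡ suc (sum excess)
  shift-multiplicity rk-step j = +-cancelʳ-≡ (rk σ) _ _ (begin
    sum shifts + rk σ                   ≡⟨ cong (sum shifts +_) (multiplicity≡rk σ j) ⟨
    sum shifts + multiplicity σ j       ≡⟨ ∑-distrib-+ shifts (λ i → 𝟙 (inS σ i j)) ⟨
    sum (λ i → shifts i + 𝟙 (inS σ i j)) ≡⟨ sum-cong-≗ (λ i → inShift+inS i j) ⟩
    sum (λ i → 𝟙 (inS π i j) + excess i) ≡⟨ ∑-distrib-+ (λ i → 𝟙 (inS π i j)) excess ⟩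
    multiplicity π j + sum excess       ≡⟨ cong (_+ sum excess) (multiplicity≡rk π j) ⟩
    rk π + sum excess                   ≡⟨ cong (_+ sum excess) rk-step ⟨
    suc (rk σ + sum excess)             ≡⟨ cong suc (+-comm (rk σ) (sum excess)) ⟩
    suc (sum excess) + rk σ             ∎)
    where
      open ≡-Reasoning
      shifts : Fin n → ℕ
      shifts i = 𝟙 (inShift π σ i j)

  exactly-once⇔no-excess : suc (rk σ) ≡ rk π → ∀ j → ExactlyOne (λ i → inShift π σ i j) ⇔ sum excess ≡ 0
  exactly-once⇔no-excess rk-step j = mk⇔
    (λ once → suc-injective (trans (sym (shift-multiplicity rk-step j)) (from counting once)))
    (λ none → to counting (trans (shift-multiplicity rk-step j) (cong suc none)))
    where
      open Equivalence
      counting : sum (λ i → 𝟙 (inShift π σ i j)) ≡ 1 ⇔ ExactlyOne (λ i → inShift π σ i j)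
      counting = sum-𝟙≡1⇔ExactlyOne (λ i → inShift π σ i j)

  no-excess⇔⊆ : sum excess ≡ 0 ⇔ (∀ i j → inS σ i j ≡ true → inS π i j ≡ true)
  no-excess⇔⊆ = mk⇔ (λ none i → to (excess≡0⇔⊆ i) (sum≡0⇒ excess none i))
                    (λ ⊆ → sum-zero (λ i → from (excess≡0⇔⊆ i) (⊆ i)))
    where open Equivalence

lemma3p13 : (n : ℕ) → (σ π : DecoratedPerm n) → suc (rk σ) ≡ rk π →
    (((∀ j → ∃ λ i → inShift π σ i j ≡ true)
      × (∀ i i′ j → inShift π σ i j ≡ true → inShift π σ i′ j ≡ true → i ≡ i′))
    ⇔ (∀ i j → inS σ i j ≡ true → inS π i j ≡ true))
lemma3p13 n σ π rk-step = mk⇔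
  (λ (covers , disjoint) i j →
    to (no-excess⇔⊆ π σ) (to (exactly-once⇔no-excess π σ rk-step j) (covers j , λ i i′ → disjoint i i′ j)) i j)
  (λ ⊆ → (λ j → proj₁ (once ⊆ j)) , (λ i i′ j → proj₂ (once ⊆ j) i i′))
  where
    open Equivalence
    once : (∀ i j → inS σ i j ≡ true → inS π i j ≡ true) → ∀ j → ExactlyOne (λ i → inShift π σ i j)
    once ⊆ j = from (exactly-once⇔no-excess π σ rk-step j) (from (no-excess⇔⊆ π σ) ⊆)
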